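{- Let $n \ge 2$ be an integer. Suppose there exist positive integers $x_0, t_0$ with $4x_0 > n$ and a nonnegative integer $q$ such that $$t_0^2 (4x_0 - n)^2 - 2 n t_0 x_0 = q^2.$$ Then $y = t_0(4x_0 - n) - q$ and $z = t_0(4x_0 - n) + q$ are positive integers and $$\frac{4}{n} = \frac{1}{x_0} + \frac{1}{y} + \frac{1}{z}.$$ -}

module Defs where

open import Data.Nat using (ℕ; suc)
open import Data.Integer using (ℤ; +_; -[1+_]; _<_; 0ℤ; +<+)
open import Data.Rational using (ℚ; _/_)

recipℤ : (y : ℤ) → 0ℤ < y → ℚ
recipℤ (+ suc k) _ = + 1 / suc k
recipℤ (+ 0) (+<+ ())

-- Put A = t₀(4x₀ − n), y = A − q and z = A + q. Then y + z = 2A and yz = A² − q² = 2n t₀ x₀,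
-- so 1/y + 1/z = 2A / (2n t₀ x₀) = (4x₀ − n) / (n x₀) = 4/n − 1/x₀. Positivity of y comes from
-- q² = A² − 2n t₀ x₀ < A² together with A > 0.
module Submission where

open import Defs
open import Data.Nat using (ℕ; _≥_; NonZero; suc; z≤n; s≤s; >-nonZero⁻¹)
open import Data.Integer using (ℤ; +_; _+_; _-_; _*_; _<_; _≤_; 0ℤ; +<+; +≤+; -_; positive; nonNegative)
open import Data.Integer.Properties
  using (_<?_; ≮⇒≥; <⇒≱; <⇒≤; ≤-trans; +-monoʳ-<; +-monoˡ-<; +-mono-<-≤; +-inverseʳ; +-identityʳ;
         *-monoˡ-<-pos; *-monoˡ-≤-nonNeg; *-monoʳ-≤-nonNeg; *-zeroʳ; neg-mono-<)
open import Data.Integer.Tactic.RingSolver using (solve-∀)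
open import Data.Rational using (_/_; fromℚᵘ; toℚᵘ) renaming (_+_ to _+ℚ_)
open import Data.Rational.Properties using (toℚᵘ-injective; toℚᵘ-fromℚᵘ; toℚᵘ-homo-+; fromℚᵘ-cong)
import Data.Rational.Unnormalised as ℚᵘ
import Data.Rational.Unnormalised.Properties as ℚᵘ
open import Data.Product using (Σ; _,_)
open import Relation.Binary.PropositionalEquality using (_≡_; trans; cong; subst; module ≡-Reasoning)
open import Relation.Nullary using (yes; no; contradiction)

i<j⇒0<j-i : ∀ {i j} → i < j → 0ℤ < j - i
i<j⇒0<j-i {i} {j} i<j = subst (_< j - i) (+-inverseʳ i) (+-monoˡ-< (- i) i<j)

i-j<i : ∀ i {j} → 0ℤ < j → i - j < i
i-j<i i {j} 0<j = subst (i - j <_) (+-identityʳ i) (+-monoʳ-< i (neg-mono-< 0<j))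

0<i*j : ∀ {i j} → 0ℤ < i → 0ℤ < j → 0ℤ < i * j
0<i*j {i} {j} 0<i 0<j = subst (_< i * j) (*-zeroʳ i) (*-monoˡ-<-pos i {{positive 0<i}} 0<j)

i*i<j*j⇒i<j : ∀ {i j} → 0ℤ ≤ j → i * i < j * j → i < j
i*i<j*j⇒i<j {i} {j} 0≤j i²<j² with i <? j
... | yes i<j = i<j
... | no i≮j = contradiction j*j≤i*i (<⇒≱ i²<j²)
  where
    j≤i : j ≤ i
    j≤i = ≮⇒≥ i≮j
    j*j≤i*i : j * j ≤ i * i
    j*j≤i*i = ≤-trans (*-monoˡ-≤-nonNeg j {{nonNegative 0≤j}} j≤i)
                      (*-monoʳ-≤-nonNeg i {{nonNegative (≤-trans 0≤j j≤i)}} j≤i)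

fromℚᵘ-homo-+ : ∀ p q → fromℚᵘ (p ℚᵘ.+ q) ≡ fromℚᵘ p +ℚ fromℚᵘ q
fromℚᵘ-homo-+ p q = toℚᵘ-injective (begin
  toℚᵘ (fromℚᵘ (p ℚᵘ.+ q))              ≈⟨ toℚᵘ-fromℚᵘ (p ℚᵘ.+ q) ⟩
  p ℚᵘ.+ q                               ≈⟨ ℚᵘ.+-cong (toℚᵘ-fromℚᵘ p) (toℚᵘ-fromℚᵘ q) ⟨
  toℚᵘ (fromℚᵘ p) ℚᵘ.+ toℚᵘ (fromℚᵘ q)  ≈⟨ toℚᵘ-homo-+ (fromℚᵘ p) (fromℚᵘ q) ⟨
  toℚᵘ (fromℚᵘ p +ℚ fromℚᵘ q)            ∎)
  where open ℚᵘ.≃-Reasoning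

/≡recipℤ+recipℤ+recipℤ : ∀ m n .{{_ : NonZero n}} x y z (hx : 0ℤ < x) (hy : 0ℤ < y) (hz : 0ℤ < z)
  → m * (x * y * z) ≡ (y * z + x * z + x * y) * + n
  → m / n ≡ recipℤ x hx +ℚ recipℤ y hy +ℚ recipℤ z hz
/≡recipℤ+recipℤ+recipℤ m (suc n) (+ suc x) (+ suc y) (+ suc z) _ _ _ eq = begin
  fromℚᵘ (ℚᵘ.mkℚᵘ m n)                          ≡⟨ fromℚᵘ-cong {ℚᵘ.mkℚᵘ m n} {1/ x ℚᵘ.+ 1/ y ℚᵘ.+ 1/ z}
                                                     (ℚᵘ.*≡* (trans eq (numerator-of-sum (+ suc x) (+ suc y) (+ suc z) (+ suc n)))) ⟩
  fromℚᵘ (1/ x ℚᵘ.+ 1/ y ℚᵘ.+ 1/ z)             ≡⟨ fromℚᵘ-homo-+ (1/ x ℚᵘ.+ 1/ y) (1/ z) ⟩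
  fromℚᵘ (1/ x ℚᵘ.+ 1/ y) +ℚ fromℚᵘ (1/ z)      ≡⟨ cong (_+ℚ fromℚᵘ (1/ z)) (fromℚᵘ-homo-+ (1/ x) (1/ y)) ⟩
  fromℚᵘ (1/ x) +ℚ fromℚᵘ (1/ y) +ℚ fromℚᵘ (1/ z) ∎
  where
    open ≡-Reasoning
    1/_ : ℕ → ℚᵘ.ℚᵘ
    1/ k = ℚᵘ.mkℚᵘ (+ 1) k
    -- The bracket on the right is the numerator of 1/x + 1/y + 1/z as ℚᵘ's addition computes it.
    numerator-of-sum : ∀ x y z n → (y * z + x * z + x * y) * n ≡ ((+ 1 * y + + 1 * x) * z + + 1 * (x * y)) * n
    numerator-of-sum = solve-∀
/≡recipℤ+recipℤ+recipℤ _ _ (+ 0) _ _ (+<+ ()) _ _ _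
/≡recipℤ+recipℤ+recipℤ _ _ _ (+ 0) _ _ (+<+ ()) _ _
/≡recipℤ+recipℤ+recipℤ _ _ _ _ (+ 0) _ _ (+<+ ()) _

clearing-denominators-identity : ∀ t x n q → let A = t * (+ 4 * x - n) in
  + 4 * (x * (A - q) * (A + q))
    ≡ ((A - q) * (A + q) + x * (A + q) + x * (A - q)) * n + (+ 4 * x - n) * ((A * A - + 2 * n * t * x) - q * q)
clearing-denominators-identity = solve-∀

clearing-denominators : ∀ t x n q → let A = t * (+ 4 * x - n) in
  A * A - + 2 * n * t * x ≡ q * q
  → + 4 * (x * (A - q) * (A + q)) ≡ ((A - q) * (A + q) + x * (A + q) + x * (A - q)) * n
clearing-denominators t x n q eq = begin
  + 4 * (x * (A - q) * (A + q))              ≡⟨ clearing-denominators-identity t x n q ⟩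
  S + (+ 4 * x - n) * (A * A - P - q * q)    ≡⟨ cong (λ e → S + (+ 4 * x - n) * (e - q * q)) eq ⟩
  S + (+ 4 * x - n) * (q * q - q * q)        ≡⟨ cong (λ e → S + (+ 4 * x - n) * e) (+-inverseʳ (q * q)) ⟩
  S + (+ 4 * x - n) * 0ℤ                     ≡⟨ cong (λ e → S + e) (*-zeroʳ (+ 4 * x - n)) ⟩
  S + 0ℤ                                     ≡⟨ +-identityʳ S ⟩
  S                                          ∎
  where
    open ≡-Reasoning
    A P S : ℤ
    A = t * (+ 4 * x - n)
    P = + 2 * n * t * x
    S = ((A - q) * (A + q) + x * (A + q) + x * (A - q)) * n

mainTheorem2 : (n : ℕ) → .{{_ : NonZero n}} → n ≥ 2 → (x₀ t₀ q : ℕ) → (hx : 0ℤ < + x₀) → 0ℤ < + t₀ → + n < + 4 * + x₀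
    → + t₀ * (+ 4 * + x₀ - + n) * (+ t₀ * (+ 4 * + x₀ - + n)) - + 2 * + n * + t₀ * + x₀ ≡ + q * + q
    → Σ (0ℤ < + t₀ * (+ 4 * + x₀ - + n) - + q) λ hy →
      Σ (0ℤ < + t₀ * (+ 4 * + x₀ - + n) + + q) λ hz →
        + 4 / n ≡ recipℤ (+ x₀) hx +ℚ recipℤ (+ t₀ * (+ 4 * + x₀ - + n) - + q) hy +ℚ recipℤ (+ t₀ * (+ 4 * + x₀ - + n) + + q) hz
mainTheorem2 n _ x₀ t₀ q hx ht n<4x₀ eq = hy , hz ,
  /≡recipℤ+recipℤ+recipℤ (+ 4) n (+ x₀) (A - + q) (A + + q) hx hy hz
    (clearing-denominators (+ t₀) (+ x₀) (+ n) (+ q) eq)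
  where
    A : ℤ
    A = + t₀ * (+ 4 * + x₀ - + n)
    0<A : 0ℤ < A
    0<A = 0<i*j ht (i<j⇒0<j-i n<4x₀)
    0<2nt₀x₀ : 0ℤ < + 2 * + n * + t₀ * + x₀
    0<2nt₀x₀ = 0<i*j (0<i*j (0<i*j {+ 2} (+<+ (s≤s z≤n)) (+<+ (>-nonZero⁻¹ n))) ht) hx
    q<A : + q < A
    q<A = i*i<j*j⇒i<j (<⇒≤ 0<A) (subst (_< A * A) eq (i-j<i (A * A) 0<2nt₀x₀))
    hy : 0ℤ < A - + q
    hy = i<j⇒0<j-i q<A
    hz : 0ℤ < A + + q
    hz = +-mono-<-≤ 0<A (+≤+ z≤n)
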